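{- Let $K$ be a field of characteristic zero, and let $F: y^2=f(x)$ and $G: y^2=g(x)$ be elliptic curves over $K$ with $f,g$ monic separable cubics with full $K$-rational $2$-torsion. Let $\alpha_1,\alpha_2,\alpha_3$ and $\beta_1,\beta_2,\beta_3$ be the roots of $f$ and $g$ (indices mod $3$), and let $\mathrm{glue}(f,g)$ be defined as in the context (assumed well defined). For a nonzero integer $d$ put $f^{(d)}(x)=d^3f(x/d)$ and $g^{(d)}(x)=d^3g(x/d)$, with roots ordered as $d\alpha_i$ and $d\beta_i$. Then the curve $C^{(d)}: dy^2=\mathrm{glue}(f,g)(x)$ is isomorphic to the curve $y^2=\mathrm{glue}(f^{(d)},g^{(d)})(x)$.
   Context: Define $a_1=\sum_{i=1}^3\frac{(\alpha_{i+2}-\alpha_{i+1})^2}{\beta_{i+2}-\beta_{i+1}}$, $b_1=\sum_{i=1}^3\frac{(\beta_{i+2}-\beta_{i+1})^2}{\alpha_{i+2}-\alpha_{i+1}}$, $a_2=\sum_{i=1}^3\alpha_i(\beta_{i+2}-\beta_{i+1})$, $b_2=\sum_{i=1}^3\beta_i(\alpha_{i+2}-\alpha_{i+1})$, $A=\mathrm{disc}(g)\,a_1/a_2$, $B=\mathrm{disc}(f)\,b_1/b_2$, and $$\mathrm{glue}(f,g)(x)=-\prod_{i=1}^3\Big(A(\alpha_{i+1}-\alpha_i)(\alpha_i-\alpha_{i-1})x^2+B(\beta_{i+1}-\beta_i)(\beta_i-\beta_{i+2})\Big),$$ indices mod $3$. (When defined and separable, $y^2=\mathrm{glue}(f,g)$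 is a genus-$2$ curve with Jacobian isomorphic to $F\times G$.) -}

module Defs where

open import Level using (Level; _⊔_) renaming (suc to lsuc)
open import Algebra.Bundles using (CommutativeRing)
open import Data.Nat using (ℕ; zero; suc)
open import Data.Integer using (ℤ; +_; -[1+_])
open import Data.Fin using (Fin; zero; suc)
open import Data.Product using (Σ; _×_; _,_)
open import Relation.Binary.PropositionalEquality using (_≡_)
open import Relation.Nullary using (¬_)

-- The inverse is a total operation
-- (the value at 0 is irrelevant), required to respect the setoid equality.
record Field (c ℓ : Level) : Set (lsuc (c ⊔ ℓ)) where
  field
    commutativeRing : CommutativeRing c ℓ
  open CommutativeRing commutativeRing public
  infix 8 _⁻¹
  field
    _⁻¹      : Carrier → Carrier
    ⁻¹-cong  : ∀ {x y} → x ≈ y → x ⁻¹ ≈ y ⁻¹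
    inverse  : ∀ x → ¬ (x ≈ 0#) → x * (x ⁻¹) ≈ 1#
    0≉1      : ¬ (0# ≈ 1#)

module _ {c ℓ} (K : Field c ℓ) where
  open Field K hiding (zero)

  infixl 7 _÷_
  _÷_ : Carrier → Carrier → Carrier
  x ÷ y = x * (y ⁻¹)

  _² : Carrier → Carrier
  x ² = x * x

  natK : ℕ → Carrier
  natK zero    = 0#
  natK (suc n) = 1# + natK n

  intK : ℤ → Carrier
  intK (+ n)      = natK n
  intK -[1+ n ]   = - natK (suc n)

  CharZero : Set ℓ
  CharZero = ∀ n → ¬ (natK (suc n) ≈ 0#)

  next : Fin 3 → Fin 3
  next zero             = suc zero
  next (suc zero)       = suc (suc zero)
  next (suc (suc zero)) = zero

  prev : Fin 3 → Fin 3
  prev zero             = suc (suc zero)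
  prev (suc zero)       = zero
  prev (suc (suc zero)) = suc zero

  sum3 : (Fin 3 → Carrier) → Carrier
  sum3 h = h zero + h (suc zero) + h (suc (suc zero))

  prod3 : (Fin 3 → Carrier) → Carrier
  prod3 h = h zero * h (suc zero) * h (suc (suc zero))

  -- the three roots are pairwise distinct (f = ∏ (x - α i) separable)
  Distinct : (Fin 3 → Carrier) → Set ℓ
  Distinct α = ∀ i j → ¬ (i ≡ j) → ¬ (α i ≈ α j)

  disc : (Fin 3 → Carrier) → Carrier
  disc α = ((α zero - α (suc zero)) * (α zero - α (suc (suc zero)))
            * (α (suc zero) - α (suc (suc zero)))) ²

  module Glue (α β : Fin 3 → Carrier) where
    i+1 i+2 : Fin 3 → Fin 3
    i+1 = next
    i+2 i = next (next i)

    a₁ b₁ a₂ b₂ A B : Carrier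
    a₁ = sum3 λ i → (α (i+2 i) - α (i+1 i)) ² ÷ (β (i+2 i) - β (i+1 i))
    b₁ = sum3 λ i → (β (i+2 i) - β (i+1 i)) ² ÷ (α (i+2 i) - α (i+1 i))
    a₂ = sum3 λ i → α i * (β (i+2 i) - β (i+1 i))
    b₂ = sum3 λ i → β i * (α (i+2 i) - α (i+1 i))
    A  = disc β * a₁ ÷ a₂
    B  = disc α * b₁ ÷ b₂

    -- glue(f,g) as the binary sextic form in (x : z), i.e. the
    -- homogenisation of glue(f,g)(x) in degree 6
    glueForm : Carrier → Carrier → Carrier
    glueForm x z = - prod3 λ i →
        A * (α (next i) - α i) * (α i - α (prev i)) * x ²
      + B * (β (next i) - β i) * (β i - β (i+2 i)) * z ²

  -- glue(f,g) is well defined: the denominators a₂, b₂ are nonzero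
  -- (the other denominators are nonzero by separability)
  GlueDefined : (Fin 3 → Carrier) → (Fin 3 → Carrier) → Set ℓ
  GlueDefined α β = ¬ (Glue.a₂ α β ≈ 0#) × ¬ (Glue.b₂ α β ≈ 0#)

  glue : (Fin 3 → Carrier) → (Fin 3 → Carrier) → Carrier → Carrier → Carrier
  glue α β = Glue.glueForm α β

  -- roots of f^(d)(x) = d³ f(x/d), ordered as d·α i
  twistRoots : ℤ → (Fin 3 → Carrier) → (Fin 3 → Carrier)
  twistRoots d α i = intK d * α i

  -- A curve  c·y² = H(x,z)  with H a binary sextic form (weighted
  -- projective model of the genus-2 curve c·y² = H(x,1)).
  Curve : Set c
  Curve = Carrier × (Carrier → Carrier → Carrier)

  -- Isomorphism of such curves over K: a change of variables
  -- (x,z,y) ↦ (a x + b z, c' x + d z, e y) with ad - bc' ≠ 0, e ≠ 0,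
  -- carrying the second curve onto the first, i.e. the identity
  --   c₂ · H₁(a x + b z, c' x + d z) = c₁ · e² · H₂(x, z)
  -- of binary forms (checked pointwise; K is infinite as char K = 0).
  CurveIso : Curve → Curve → Set (c ⊔ ℓ)
  CurveIso (c₁ , H₁) (c₂ , H₂) =
    Σ Carrier λ a → Σ Carrier λ b → Σ Carrier λ c' → Σ Carrier λ d →
    Σ Carrier λ e →
      ¬ (a * d - b * c' ≈ 0#) × ¬ (e ≈ 0#) ×
      (∀ x z → c₂ * H₁ (a * x + b * z) (c' * x + d * z) ≈ c₁ * e ² * H₂ x z)

{-# OPTIONS --safe #-}
-- Scaling all roots by t multiplies every difference of roots by t, hence disc by t⁶, a₁ by t,
-- a₂ by t², A and B by t⁵, and each quadratic factor of glue by t⁷: glue(tα, tβ) = t²¹ glue(α, β).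
-- Since glue is a sextic form, the substitution (x, z, y) ↦ (t⁴x, t⁴z, t y) turns
-- t y² = glue(α, β) into y² = glue(tα, tβ), as (t⁴)⁶ = t · t² · t²¹.
module Submission where

open import Defs hiding (_÷_; _²)
open import Data.Fin using (Fin; zero; suc)
open import Data.Integer using (ℤ; +_; -[1+_])
open import Data.Nat using () renaming (zero to ℕ-zero; suc to ℕ-suc)
open import Data.Product using (_,_)
open import Function using (_∘_)
open import Relation.Binary.PropositionalEquality using (_≡_) renaming (refl to ≡-refl)
open import Relation.Nullary using (¬_)

module _ {c ℓ} (K : Field c ℓ) where
  open Field K hiding (zero)
  open import Algebra.Properties.Ring ring
    using (-0#≈0#; -‿injective; -‿distribʳ-*; x[y-z]≈xy-xz; x∙y⁻¹≈ε⇒x≈y)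
  open import Algebra.Properties.Semiring.Exp semiring using (_^_)
  open import Algebra.Solver.Ring.NaturalCoefficients.Default commutativeSemiring
  open import Relation.Binary.Reasoning.Setoid setoid

  private
    infixl 7 _÷_
    _÷_ : Carrier → Carrier → Carrier
    _÷_ = Defs._÷_ K

    _² : Carrier → Carrier
    _² = Defs._² K

  *-nonzero : ∀ {x y} → ¬ x ≈ 0# → ¬ y ≈ 0# → ¬ x * y ≈ 0#
  *-nonzero {x} {y} x≉0 y≉0 xy≈0 = 0≉1 (sym (begin
    1#                      ≈⟨ *-identityˡ 1# ⟨
    1# * 1#                 ≈⟨ *-cong (inverse x x≉0) (inverse y y≉0) ⟨
    (x * x ⁻¹) * (y * y ⁻¹) ≈⟨ solve 4 (λ x x' y y' → (x :* x') :* (y :* y') := (x :* y) :* (x' :* y'))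
                                   refl x (x ⁻¹) y (y ⁻¹) ⟩
    (x * y) * (x ⁻¹ * y ⁻¹) ≈⟨ *-congʳ xy≈0 ⟩
    0# * (x ⁻¹ * y ⁻¹)      ≈⟨ zeroˡ _ ⟩
    0#                      ∎))

  ^-nonzero : ∀ {x} → ¬ x ≈ 0# → ∀ n → ¬ x ^ n ≈ 0#
  ^-nonzero x≉0 ℕ-zero    = 0≉1 ∘ sym
  ^-nonzero x≉0 (ℕ-suc n) = *-nonzero x≉0 (^-nonzero x≉0 n)

  ÷-cong : ∀ {x x' y y'} → x ≈ x' → y ≈ y' → x ÷ y ≈ x' ÷ y'
  ÷-cong x≈x' y≈y' = *-cong x≈x' (⁻¹-cong y≈y')

  ÷-cancelʳ : ∀ {y z} → ¬ y ≈ 0# → ¬ z ≈ 0# → ∀ x → x * z ÷ (y * z) ≈ x ÷ y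
  ÷-cancelʳ {y} {z} y≉0 z≉0 x = begin
    x * z * (y * z) ⁻¹                    ≈⟨ *-identityʳ _ ⟨
    x * z * (y * z) ⁻¹ * 1#               ≈⟨ *-congˡ (inverse y y≉0) ⟨
    x * z * (y * z) ⁻¹ * (y * y ⁻¹)       ≈⟨ solve 5 (λ x y z w y' → x :* z :* w :* (y :* y') := x :* y' :* (y :* z :* w))
                                                 refl x y z ((y * z) ⁻¹) (y ⁻¹) ⟩
    x * y ⁻¹ * ((y * z) * (y * z) ⁻¹)     ≈⟨ *-congˡ (inverse (y * z) (*-nonzero y≉0 z≉0)) ⟩
    x * y ⁻¹ * 1#                         ≈⟨ *-identityʳ _ ⟩
    x * y ⁻¹                              ∎

  intK-nonzero : CharZero K → ∀ {d} → ¬ d ≡ + 0 → ¬ intK K d ≈ 0#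
  intK-nonzero char0 {+ ℕ-zero}  d≢0 _  = d≢0 ≡-refl
  intK-nonzero char0 {+ ℕ-suc n} d≢0 eq = char0 n eq
  intK-nonzero char0 { -[1+ n ] } d≢0 eq = char0 n (-‿injective (trans eq (sym -0#≈0#)))

  scalarMatrix-det≉0 : ∀ {u} → ¬ u ≈ 0# → ¬ u * u - 0# * 0# ≈ 0#
  scalarMatrix-det≉0 {u} u≉0 det≈0 = *-nonzero u≉0 u≉0 (begin
    u * u               ≈⟨ +-identityʳ _ ⟨
    u * u + 0#          ≈⟨ +-congˡ (trans (-‿cong (zeroˡ 0#)) -0#≈0#) ⟨
    u * u - 0# * 0#     ≈⟨ det≈0 ⟩
    0#                  ∎)

  scale-diff : ∀ t p q → t * p - t * q ≈ t * (p - q)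
  scale-diff t p q = sym (x[y-z]≈xy-xz t p q)

  sum3-scale : ∀ {s f g} → (∀ i → g i ≈ s * f i) → sum3 K g ≈ s * sum3 K f
  sum3-scale {s} {f} g≈sf = trans
    (+-cong (+-cong (g≈sf zero) (g≈sf (suc zero))) (g≈sf (suc (suc zero))))
    (solve 4 (λ s x y z → s :* x :+ s :* y :+ s :* z := s :* (x :+ y :+ z))
      refl s (f zero) (f (suc zero)) (f (suc (suc zero))))

  -prod3-scale : ∀ {s f g} → (∀ i → g i ≈ s * f i) → - prod3 K g ≈ s ^ 3 * - prod3 K f
  -prod3-scale {s} {f} {g} g≈sf = begin
    - prod3 K g
      ≈⟨ -‿cong (*-cong (*-cong (g≈sf zero) (g≈sf (suc zero))) (g≈sf (suc (suc zero)))) ⟩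
    - (s * f zero * (s * f (suc zero)) * (s * f (suc (suc zero))))
      ≈⟨ -‿cong (solve 4 (λ s x y z → s :* x :* (s :* y) :* (s :* z) := s :^ 3 :* (x :* y :* z))
                   refl s (f zero) (f (suc zero)) (f (suc (suc zero)))) ⟩
    - (s ^ 3 * prod3 K f)
      ≈⟨ -‿distribʳ-* _ _ ⟩
    s ^ 3 * - prod3 K f ∎

  infixr 8 _·_
  _·_ : Carrier → (Fin 3 → Carrier) → Fin 3 → Carrier
  (t · α) i = t * α i

  disc-scale : ∀ t α → disc K (t · α) ≈ t ^ 6 * disc K α
  disc-scale t α = trans (*-cong t³Δ t³Δ)
    (solve 4 (λ t x y z → t :* x :* (t :* y) :* (t :* z) :* (t :* x :* (t :* y) :* (t :* z))
                           := t :^ 6 :* (x :* y :* z :* (x :* y :* z)))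
      refl t (α₀ - α₁) (α₀ - α₂) (α₁ - α₂))
    where
      α₀ = α zero
      α₁ = α (suc zero)
      α₂ = α (suc (suc zero))
      t³Δ = *-cong (*-cong (scale-diff t α₀ α₁) (scale-diff t α₀ α₂)) (scale-diff t α₁ α₂)

  ratio-scale : ∀ {t r s} → ¬ t ≈ 0# → ¬ r ≈ s → ∀ p q →
    (t * p - t * q) ² ÷ (t * r - t * s) ≈ t * ((p - q) ² ÷ (r - s))
  ratio-scale {t} {r} {s} t≉0 r≉s p q = begin
    (t * p - t * q) ² ÷ (t * r - t * s)
      ≈⟨ ÷-cong (*-cong (scale-diff t p q) (scale-diff t p q)) (scale-diff t r s) ⟩
    (t * (p - q)) ² ÷ (t * (r - s))
      ≈⟨ ÷-cong (solve 2 (λ t x → t :* x :* (t :* x) := t :* (x :* x) :* t) refl t (p - q))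
                (*-comm t _) ⟩
    t * (p - q) ² * t ÷ ((r - s) * t)
      ≈⟨ ÷-cancelʳ (r≉s ∘ x∙y⁻¹≈ε⇒x≈y r s) t≉0 _ ⟩
    t * (p - q) ² ÷ (r - s)
      ≈⟨ *-assoc t _ _ ⟩
    t * ((p - q) ² ÷ (r - s)) ∎

  next²≢next : ∀ i → ¬ next K (next K i) ≡ next K i
  next²≢next zero ()
  next²≢next (suc zero) ()
  next²≢next (suc (suc zero)) ()

  module _ {t} (t≉0 : ¬ t ≈ 0#) (α β : Fin 3 → Carrier) where
    open Glue K

    a₁-scale : Distinct K β → a₁ (t · α) (t · β) ≈ t * a₁ α β
    a₁-scale β-distinct = sum3-scale λ i →
      ratio-scale t≉0 (β-distinct (next K (next K i)) (next K i) (next²≢next i))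
        (α (next K (next K i))) (α (next K i))

    a₂-scale : a₂ (t · α) (t · β) ≈ t ^ 2 * a₂ α β
    a₂-scale = sum3-scale λ i →
      let βᵢ₊₂ = β (next K (next K i)); βᵢ₊₁ = β (next K i) in
      trans (*-congˡ (scale-diff t βᵢ₊₂ βᵢ₊₁))
        (solve 3 (λ t x y → t :* x :* (t :* y) := t :^ 2 :* (x :* y)) refl t (α i) (βᵢ₊₂ - βᵢ₊₁))

    A-scale : Distinct K β → ¬ a₂ α β ≈ 0# → A (t · α) (t · β) ≈ t ^ 5 * A α β
    A-scale β-distinct a₂≉0 = begin
      disc K (t · β) * a₁ (t · α) (t · β) ÷ a₂ (t · α) (t · β)
        ≈⟨ ÷-cong (*-cong (disc-scale t β) (a₁-scale β-distinct)) a₂-scale ⟩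
      t ^ 6 * disc K β * (t * a₁ α β) ÷ (t ^ 2 * a₂ α β)
        ≈⟨ ÷-cong (solve 3 (λ t D a → t :^ 6 :* D :* (t :* a) := t :^ 5 :* D :* a :* t :^ 2)
                           refl t _ _)
                  (*-comm _ _) ⟩
      t ^ 5 * disc K β * a₁ α β * t ^ 2 ÷ (a₂ α β * t ^ 2)
        ≈⟨ ÷-cancelʳ a₂≉0 (^-nonzero t≉0 2) _ ⟩
      t ^ 5 * disc K β * a₁ α β ÷ a₂ α β
        ≈⟨ solve 4 (λ t D a v → t :^ 5 :* D :* a :* v := t :^ 5 :* (D :* a :* v)) refl t _ _ _ ⟩
      t ^ 5 * A α β ∎

  coefficient-scale : ∀ {t A A'} → A' ≈ t ^ 5 * A → ∀ p q r →
    A' * (t * p - t * q) * (t * q - t * r) ≈ t ^ 7 * (A * (p - q) * (q - r))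
  coefficient-scale {t} {A} A'≈t⁵A p q r = trans
    (*-cong (*-cong A'≈t⁵A (scale-diff t p q)) (scale-diff t q r))
    (solve 4 (λ t A x y → t :^ 5 :* A :* (t :* x) :* (t :* y) := t :^ 7 :* (A :* x :* y))
      refl t A (p - q) (q - r))

  evenSextic : (P Q : Fin 3 → Carrier) → Carrier → Carrier → Carrier
  evenSextic P Q x z = - prod3 K λ i → P i * x ² + Q i * z ²

  evenSextic-scale : ∀ {s P Q P' Q'} → (∀ i → P' i ≈ s * P i) → (∀ i → Q' i ≈ s * Q i) →
    ∀ x z → evenSextic P' Q' x z ≈ s ^ 3 * evenSextic P Q x z
  evenSextic-scale {s} {P} {Q} P'≈sP Q'≈sQ x z = -prod3-scale λ i →
    trans (+-cong (*-congʳ (P'≈sP i)) (*-congʳ (Q'≈sQ i)))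
      (solve 5 (λ s P Q X Z → s :* P :* X :+ s :* Q :* Z := s :* (P :* X :+ Q :* Z))
        refl s (P i) (Q i) (x ²) (z ²))

  evenSextic-homogeneous : ∀ P Q u x z →
    evenSextic P Q (u * x + 0# * z) (0# * x + u * z) ≈ u ^ 6 * evenSextic P Q x z
  evenSextic-homogeneous P Q u x z = trans
    (-prod3-scale λ i → solve 5
      (λ u P Q x z → P :* ((u :* x :+ con 0 :* z) :* (u :* x :+ con 0 :* z))
                       :+ Q :* ((con 0 :* x :+ u :* z) :* (con 0 :* x :+ u :* z))
                     := u :* u :* (P :* (x :* x) :+ Q :* (z :* z)))
      refl u (P i) (Q i) x z)
    (*-congʳ (solve 1 (λ u → (u :* u) :^ 3 := u :^ 6) refl u))

  -- glue K α β is definitionally evenSextic (glueˣ α β) (glueᶻ α β).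
  glueˣ glueᶻ : (α β : Fin 3 → Carrier) → Fin 3 → Carrier
  glueˣ α β i = Glue.A K α β * (α (next K i) - α i) * (α i - α (prev K i))
  glueᶻ α β i = Glue.B K α β * (β (next K i) - β i) * (β i - β (next K (next K i)))

  glue-scale : ∀ {t α β} → ¬ t ≈ 0# → Distinct K α → Distinct K β → GlueDefined K α β →
    ∀ x z → glue K (t · α) (t · β) x z ≈ (t ^ 7) ^ 3 * glue K α β x z
  glue-scale {t} {α} {β} t≉0 α-distinct β-distinct (a₂≉0 , b₂≉0) =
    evenSextic-scale {P = glueˣ α β} {Q = glueᶻ α β}
      (λ i → coefficient-scale (A-scale t≉0 α β β-distinct a₂≉0)
               (α (next K i)) (α i) (α (prev K i)))
      (λ i → coefficient-scale (A-scale t≉0 β α α-distinct b₂≉0)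
               (β (next K i)) (β i) (β (next K (next K i))))

  glue-twist-iso : ∀ {t α β} → ¬ t ≈ 0# → Distinct K α → Distinct K β → GlueDefined K α β →
    CurveIso K (t , glue K α β) (1# , glue K (t · α) (t · β))
  glue-twist-iso {t} {α} {β} t≉0 α-distinct β-distinct defined =
    t ^ 4 , 0# , 0# , t ^ 4 , t , scalarMatrix-det≉0 (^-nonzero t≉0 4) , t≉0 , λ x z → begin
      1# * glue K α β (t ^ 4 * x + 0# * z) (0# * x + t ^ 4 * z)
        ≈⟨ *-identityˡ _ ⟩
      glue K α β (t ^ 4 * x + 0# * z) (0# * x + t ^ 4 * z)
        ≈⟨ evenSextic-homogeneous (glueˣ α β) (glueᶻ α β) (t ^ 4) x z ⟩
      (t ^ 4) ^ 6 * glue K α β x z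
        ≈⟨ solve 2 (λ t g → (t :^ 4) :^ 6 :* g := t :* (t :* t) :* ((t :^ 7) :^ 3 :* g)) refl t _ ⟩
      t * t ² * ((t ^ 7) ^ 3 * glue K α β x z)
        ≈⟨ *-congˡ (glue-scale t≉0 α-distinct β-distinct defined x z) ⟨
      t * t ² * glue K (t · α) (t · β) x z ∎

lemma2p19 : ∀ {c ℓ} (K : Field c ℓ) → CharZero K →
    (α β : Fin 3 → Field.Carrier K) →
    Distinct K α → Distinct K β → GlueDefined K α β →
    (d : ℤ) → ¬ (d ≡ + 0) →
    CurveIso K (intK K d , glue K α β)
      (Field.1# K , glue K (twistRoots K d α) (twistRoots K d β))
lemma2p19 K char0 α β α-distinct β-distinct defined d d≢0 =
  glue-twist-iso K (intK-nonzero K char0 d≢0) α-distinct β-distinct defined
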